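{- Let $\mathcal{U}$ be a universe. Then $(\hat{\mathcal{U}},\geq_{\mathcal{U}})$ is a pomonoid: for all $G,H,J\in\hat{\mathcal{U}}$ with $G\geq_{\mathcal{U}}H$, we have $G+J\geq_{\mathcal{U}}H+J$.
   Context: Games are short partizan game forms under the misère convention (a player unable to move wins); $+$ is the disjunctive sum; outcome classes are ordered $\mathscr{L}>\mathscr{N}>\mathscr{R}$, $\mathscr{L}>\mathscr{P}>\mathscr{R}$. Augmented forms (Siegel): game forms in which each subposition may additionally carry a Left and/or Right tombstone (formal markers, not options); a player to move on a position with no options for them or carrying their tombstone wins immediately; $G+H$ carries a Left tombstone iff both summands have no Left options or a Left tombstone and at least one carries a Left tombstone (symmetrically for Right). For a set of games $\mathcal{A}$, $G\geq_{\mathcal{A}}H$ means $o(G+X)\geq o(H+X)$ for all $X\in\mathcal{A}$, and $\equiv_{\mathcal{A}}$ means both directions. A universe is a set $\mathcal{U}$ of games closed under sums, conjugates, options, and formation of $\{\mathscr{G}\mid\mathscr{H}\}$ for finite non-empty $\mathscr{G},\mathscr{H}\subseteq\mathcal{U}$. $\hat{\mathcal{U}}$ (Siegel) is the set of augmented forms admitting a $\mathcal{U}$-expansion, i.e. whose tombstones can be replaced by $\mathcal{U}$-end-reversible options in $\mathcal{U}$ so as to recover a game form in $\mathcal{U}$; every element of $\hat{\mathcal{U}}$ is $\equiv_{\mathcal{U}}$ to a game in $\mathcal{U}$, $\hat{\mathcal{U}}$ is closed under addition, and $(\hat{\mathcal{U}},\equiv_{\mathcal{U}})$ is a monoid (if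 $G\equiv_{\mathcal{U}}H$ then $G+J\equiv_{\mathcal{U}}H+J$ for $G,H,J\in\hat{\mathcal{U}}$). -}

module Defs where

open import Data.Bool using (Bool; true; false; _∧_; _∨_; not; T)
open import Data.List using (List; []; _∷_; _++_; null)
open import Data.List.Relation.Unary.All using (All)
open import Data.List.Relation.Unary.Any using (Any)
open import Data.List.Membership.Propositional using (_∈_)
open import Data.List.Relation.Binary.Pointwise using (Pointwise)
open import Data.Product using (Σ; _×_; ∃-syntax)
open import Relation.Binary.PropositionalEquality using (_≡_; _≢_)

-- Augmented forms (short, partizan).  `mk tl tr GL GR` is the form with
-- Left options GL, Right options GR, carrying a Left tombstone iff tl
-- and a Right tombstone iff tr.  Ordinary game forms are the augmented
-- forms with no tombstone anywhere (predicate `TombFree`).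

data AForm : Set where
  mk : (tl tr : Bool) (GL GR : List AForm) → AForm

leftOpts : AForm → List AForm
leftOpts (mk _ _ GL _) = GL

rightOpts : AForm → List AForm
rightOpts (mk _ _ _ GR) = GR

data TombFree : AForm → Set where
  tf : ∀ {GL GR} → All TombFree GL → All TombFree GR → TombFree (mk false false GL GR)

-- identity of forms: options are *sets* of forms (order / repetition irrelevant)
data _≅_ : AForm → AForm → Set where
  iso : ∀ {a b GL GR HL HR} →
        All (λ g → Any (g ≅_) HL) GL → All (λ h → Any (_≅ h) GL) HL →
        All (λ g → Any (g ≅_) HR) GR → All (λ h → Any (_≅ h) GR) HR →
        mk a b GL GR ≅ mk a b HL HR

-- Misère play with tombstones: a player to move on a position with no
-- options for them, or carrying their tombstone, wins immediately.

mutual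
  lWins : AForm → Bool
  lWins (mk tl _ GL _) = tl ∨ null GL ∨ anyNotR GL

  rWins : AForm → Bool
  rWins (mk _ tr _ GR) = tr ∨ null GR ∨ anyNotL GR

  anyNotR : List AForm → Bool
  anyNotR []       = false
  anyNotR (g ∷ gs) = not (rWins g) ∨ anyNotR gs

  anyNotL : List AForm → Bool
  anyNotL []       = false
  anyNotL (g ∷ gs) = not (lWins g) ∨ anyNotL gs

-- o(G) ≥ o(H) in the order L > N > R, L > P > R
-- (outcome = (who wins with Left first, who wins with Right first);
--  better for Left componentwise).
_o≥_ : AForm → AForm → Set
G o≥ H = (T (lWins H) → T (lWins G)) × (T (rWins G) → T (rWins H))

endOrTombL : AForm → Bool
endOrTombL (mk tl _ GL _) = tl ∨ null GL

endOrTombR : AForm → Bool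
endOrTombR (mk _ tr _ GR) = tr ∨ null GR

tombL : AForm → Bool
tombL (mk tl _ _ _) = tl

tombR : AForm → Bool
tombR (mk _ tr _ _) = tr

mutual
  infixl 6 _+_
  _+_ : AForm → AForm → AForm
  G@(mk a b GL GR) + H@(mk c d HL HR) =
    mk ((endOrTombL G ∧ endOrTombL H) ∧ (a ∨ c))
       ((endOrTombR G ∧ endOrTombR H) ∧ (b ∨ d))
       (sumL GL H ++ sumR G HL)
       (sumL GR H ++ sumR G HR)

  sumL : List AForm → AForm → List AForm
  sumL []       H = []
  sumL (g ∷ gs) H = (g + H) ∷ sumL gs H

  sumR : AForm → List AForm → List AForm
  sumR G []       = []
  sumR G (h ∷ hs) = (G + h) ∷ sumR G hs

mutual
  conj : AForm → AForm
  conj (mk tl tr GL GR) = mk tr tl (conjs GR) (conjs GL)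

  conjs : List AForm → List AForm
  conjs []       = []
  conjs (g ∷ gs) = conj g ∷ conjs gs

record Universe : Set₁ where
  field
    U        : AForm → Set
    games    : ∀ {G} → U G → TombFree G
    respects : ∀ {G H} → G ≅ H → U G → U H
    sums     : ∀ {G H} → U G → U H → U (G + H)
    conjs-cl : ∀ {G} → U G → U (conj G)
    optsL    : ∀ {G g} → U G → g ∈ leftOpts G → U g
    optsR    : ∀ {G g} → U G → g ∈ rightOpts G → U g
    forms    : ∀ {GL GR} → GL ≢ [] → GR ≢ [] → All U GL → All U GR →
               U (mk false false GL GR)

_≥[_]_ : AForm → Universe → AForm → Set
G ≥[ 𝒰 ] H = ∀ X → Universe.U 𝒰 X → (G + X) o≥ (H + X)

module _ (𝒰 : Universe) where
  open Universe 𝒰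

  EndRevL : AForm → AForm → Set
  EndRevL x E = ∃[ xR ] (xR ∈ rightOpts x × leftOpts xR ≡ [] × E ≥[ 𝒰 ] xR)

  EndRevR : AForm → AForm → Set
  EndRevR y E = ∃[ yL ] (yL ∈ leftOpts y × rightOpts yL ≡ [] × yL ≥[ 𝒰 ] E)

  -- a tombstone flag b is filled by the list xs of added options:
  -- none if there is no tombstone, exactly one satisfying P otherwise
  data TombFill (P : AForm → Set) : Bool → List AForm → Set where
    noTomb  : TombFill P false []
    oneTomb : ∀ {x} → P x → TombFill P true (x ∷ [])

  -- Expands A E : E is obtained from the augmented form A by replacing
  -- each tombstone with a 𝒰-end-reversible option (recursively in all
  -- subpositions).
  data Expands : AForm → AForm → Set where
    expand : ∀ {tl tr AL AR EL ER XL XR} →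
             Pointwise Expands AL EL → Pointwise Expands AR ER →
             TombFill (λ x → EndRevL x (mk false false (EL ++ XL) (ER ++ XR))) tl XL →
             TombFill (λ y → EndRevR y (mk false false (EL ++ XL) (ER ++ XR))) tr XR →
             Expands (mk tl tr AL AR) (mk false false (EL ++ XL) (ER ++ XR))

  Hat : AForm → Set
  Hat A = ∃[ E ] (Expands A E × U E)

{-# OPTIONS --safe #-}
-- Each A ∈ Û may be replaced by its expansion E_A ∈ 𝒰 even beside a second such form:
-- o(A + (B + X)) = o(E_A + (E_B + X)) for all X ∈ 𝒰.  The proof is an induction on the
-- three summands that matches moves in A with moves in E_A.  The only new situation is a
-- p-tombstone of A, which lets p stop where in E_A he has to play the end-reversible
-- option x instead.  Its reversal x^R is a p-end dominated by E_A, so a win of p with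
-- x^R in place of E_A is a win with E_A, and a winning reply to x passes through x^R.
-- Applying this to (G + J) + X, once with J and once with its expansion E_J, gives
-- o((G + J) + X) = o(G + (E_J + X)), and G ≥_𝒰 H applies in the context E_J + X ∈ 𝒰.
module Submission where

open import Defs
open import Data.Bool using (Bool; true; false; _∧_; _∨_; not; T)
open import Data.Bool.ListAction using (any)
open import Data.Bool.Properties using (∨-assoc; T-∨; T-∧; T?; not-involutive)
open import Data.Empty using (⊥-elim)
open import Data.List using (List; []; _∷_; _++_; null; map)
open import Data.List.Properties using (++-identityʳ)
open import Data.List.Relation.Unary.All using (All; []; _∷_)
open import Data.List.Relation.Unary.Any using (here; there)
import Data.List.Relation.Unary.Any as Any
open import Data.List.Relation.Unary.Any.Properties using (any⁺; any⁻)
open import Data.List.Relation.Binary.Pointwise using (Pointwise; []; _∷_)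
open import Data.List.Membership.Propositional using (_∈_; _∉_; find; lose)
open import Data.List.Membership.Propositional.Properties
  using (∈-++⁺ˡ; ∈-++⁺ʳ; ∈-++⁻; ∈-map⁺; ∈-map⁻)
open import Data.Nat using (ℕ; suc; _<_; _≤_; s≤s)
import Data.Nat as ℕ
open import Data.Nat.Induction using (<-wellFounded)
open import Data.Nat.Properties using (≤-trans; m≤m+n; m≤n+m; +-monoˡ-<; +-monoʳ-<)
open import Data.Product using (_×_; _,_; proj₁; proj₂; ∃-syntax)
open import Data.Sum using (_⊎_; inj₁; inj₂; [_,_]′)
open import Function using (_∘_; id; _⇔_; mk⇔; Equivalence)
open import Function.Properties.Equivalence using () renaming (sym to ⇔-sym; trans to ⇔-trans)
open import Induction.WellFounded using (Acc; acc)
open import Relation.Nullary using (¬_)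
open import Relation.Nullary.Decidable using (decidable-stable)
open import Relation.Binary.PropositionalEquality
  using (_≡_; refl; sym; trans; cong; cong₂; subst; subst₂)

open Equivalence using (to; from)

-- Players are booleans, `true` being Left, so that `not` gives the opponent.
Player : Set
Player = Bool

variable
  p : Player
  A B E G H P Q R X EA EB a e g h r s s₁ s₂ : AForm
  gs : List AForm
  i j k : ℕ

options : Player → AForm → List AForm
options true  = leftOpts
options false = rightOpts

tombstone : Player → AForm → Bool
tombstone true  = tombL
tombstone false = tombR

endOrTomb : Player → AForm → Bool
endOrTomb true  = endOrTombL
endOrTomb false = endOrTombR

wins : Player → AForm → Bool
wins true  = lWins
wins false = rWins

Wins EndOrTomb : Player → AForm → Set
Wins p G = T (wins p G)
EndOrTomb p G = T (endOrTomb p G)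

T-not : ∀ {b} → T (not b) ⇔ (¬ T b)
T-not {true}  = mk⇔ (λ ()) (λ ¬t → ¬t _)
T-not {false} = mk⇔ (λ _ ()) (λ _ → _)

∉-≡[] : ∀ {x : AForm} {xs} → xs ≡ [] → x ∉ xs
∉-≡[] refl ()

anyNotR≡any : ∀ gs → anyNotR gs ≡ any (not ∘ rWins) gs
anyNotR≡any []       = refl
anyNotR≡any (g ∷ gs) = cong (not (rWins g) ∨_) (anyNotR≡any gs)

anyNotL≡any : ∀ gs → anyNotL gs ≡ any (not ∘ lWins) gs
anyNotL≡any []       = refl
anyNotL≡any (g ∷ gs) = cong (not (lWins g) ∨_) (anyNotL≡any gs)

wins≡ : ∀ p G → wins p G ≡ endOrTomb p G ∨ any (not ∘ wins (not p)) (options p G)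
wins≡ true  (mk tl _ GL _) =
  trans (cong (λ b → tl ∨ null GL ∨ b) (anyNotR≡any GL)) (sym (∨-assoc tl (null GL) _))
wins≡ false (mk _ tr _ GR) =
  trans (cong (λ b → tr ∨ null GR ∨ b) (anyNotL≡any GR)) (sym (∨-assoc tr (null GR) _))

wins-cases : ∀ p G → Wins p G → EndOrTomb p G ⊎ ∃[ g ] (g ∈ options p G × ¬ Wins (not p) g)
wins-cases p G w with to (T-∨ {endOrTomb p G}) (subst T (wins≡ p G) w)
... | inj₁ end   = inj₁ end
... | inj₂ moves = inj₂ (find (Any.map (to T-not) (any⁻ _ (options p G) moves)))

wins-by-end : ∀ p G → EndOrTomb p G → Wins p G
wins-by-end p G end = subst T (sym (wins≡ p G)) (from (T-∨ {endOrTomb p G}) (inj₁ end))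

wins-by-move : ∀ p G → g ∈ options p G → ¬ Wins (not p) g → Wins p G
wins-by-move p G m ¬w =
  subst T (sym (wins≡ p G)) (from (T-∨ {endOrTomb p G}) (inj₂ (any⁺ _ (lose m (from T-not ¬w)))))

loses⇒wins-options : ∀ p G → ¬ Wins (not p) G → g ∈ options (not p) G → Wins p g
loses⇒wins-options p G ¬w m = decidable-stable (T? _) λ ¬wg →
  ¬w (wins-by-move (not p) G m (subst (λ q → ¬ Wins q _) (sym (not-involutive p)) ¬wg))

sumL≡map : ∀ gs H → sumL gs H ≡ map (_+ H) gs
sumL≡map []       H = refl
sumL≡map (g ∷ gs) H = cong (g + H ∷_) (sumL≡map gs H)

sumR≡map : ∀ G hs → sumR G hs ≡ map (G +_) hs
sumR≡map G []       = refl
sumR≡map G (h ∷ hs) = cong (G + h ∷_) (sumR≡map G hs)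

options-+ : ∀ p G H → options p (G + H) ≡ map (_+ H) (options p G) ++ map (G +_) (options p H)
options-+ true  G@(mk _ _ GL _) H@(mk _ _ HL _) = cong₂ _++_ (sumL≡map GL H) (sumR≡map G HL)
options-+ false G@(mk _ _ _ GR) H@(mk _ _ _ HR) = cong₂ _++_ (sumL≡map GR H) (sumR≡map G HR)

∈-options-+ˡ : ∀ p G H → g ∈ options p G → g + H ∈ options p (G + H)
∈-options-+ˡ p G H m = subst (_ ∈_) (sym (options-+ p G H)) (∈-++⁺ˡ (∈-map⁺ (_+ H) m))

∈-options-+ʳ : ∀ p G H → h ∈ options p H → G + h ∈ options p (G + H)
∈-options-+ʳ p G H m = subst (_ ∈_) (sym (options-+ p G H)) (∈-++⁺ʳ _ (∈-map⁺ (G +_) m))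

∈-options-+⁻ : ∀ p G H → e ∈ options p (G + H) →
               ∃[ g ] (g ∈ options p G × e ≡ g + H) ⊎ ∃[ h ] (h ∈ options p H × e ≡ G + h)
∈-options-+⁻ p G H m with ∈-++⁻ (map (_+ H) (options p G)) (subst (_ ∈_) (options-+ p G H) m)
... | inj₁ m′ = inj₁ (∈-map⁻ (_+ H) m′)
... | inj₂ m′ = inj₂ (∈-map⁻ (G +_) m′)

null-++ : ∀ (xs ys : List AForm) → null (xs ++ ys) ≡ null xs ∧ null ys
null-++ []      ys = refl
null-++ (_ ∷ _) ys = refl

null-map : ∀ (f : AForm → AForm) xs → null (map f xs) ≡ null xs
null-map f []      = refl
null-map f (_ ∷ _) = refl

null-options-+ : ∀ p G H → null (options p (G + H)) ≡ null (options p G) ∧ null (options p H)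
null-options-+ p G H = trans (cong null (options-+ p G H))
  (trans (null-++ (map (_+ H) (options p G)) _)
         (cong₂ _∧_ (null-map (_+ H) (options p G)) (null-map (G +_) (options p H))))

-- The tombstone flag of a sum only matters when neither summand has options.
endOrTomb-+-identity : ∀ a c m n → ((a ∨ m) ∧ (c ∨ n)) ∧ (a ∨ c) ∨ m ∧ n ≡ (a ∨ m) ∧ (c ∨ n)
endOrTomb-+-identity true  true  _     _     = refl
endOrTomb-+-identity true  false _     true  = refl
endOrTomb-+-identity true  false true  false = refl
endOrTomb-+-identity true  false false false = refl
endOrTomb-+-identity false true  true  _     = refl
endOrTomb-+-identity false true  false _     = refl
endOrTomb-+-identity false false true  true  = refl
endOrTomb-+-identity false false true  false = refl
endOrTomb-+-identity false false false _     = refl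

endOrTomb-+ : ∀ p G H → endOrTomb p (G + H) ≡ endOrTomb p G ∧ endOrTomb p H
endOrTomb-+ true  G@(mk a _ GL _) H@(mk c _ HL _) =
  trans (cong (_ ∨_) (null-options-+ true G H)) (endOrTomb-+-identity a c (null GL) (null HL))
endOrTomb-+ false G@(mk _ a _ GR) H@(mk _ c _ HR) =
  trans (cong (_ ∨_) (null-options-+ false G H)) (endOrTomb-+-identity a c (null GR) (null HR))

endOrTomb-+⁻ : ∀ p G H → EndOrTomb p (G + H) → EndOrTomb p G × EndOrTomb p H
endOrTomb-+⁻ p G H end = to T-∧ (subst T (endOrTomb-+ p G H) end)

endOrTomb-+⁺ : ∀ p G H → EndOrTomb p G → EndOrTomb p H → EndOrTomb p (G + H)
endOrTomb-+⁺ p G H endG endH = subst T (sym (endOrTomb-+ p G H)) (from T-∧ (endG , endH))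

endOrTomb-of-tombstone : ∀ p G → tombstone p G ≡ true → EndOrTomb p G
endOrTomb-of-tombstone true  (mk true _ _ _) _ = _
endOrTomb-of-tombstone false (mk _ true _ _) _ = _

endOrTomb-of-∉ : ∀ p G → (∀ {g} → g ∉ options p G) → EndOrTomb p G
endOrTomb-of-∉ true  (mk true  _ _       _) _ = _
endOrTomb-of-∉ true  (mk false _ []      _) _ = _
endOrTomb-of-∉ true  (mk false _ (_ ∷ _) _) ∉ = ⊥-elim (∉ (here refl))
endOrTomb-of-∉ false (mk _ true  _ _      ) _ = _
endOrTomb-of-∉ false (mk _ false _ []     ) _ = _
endOrTomb-of-∉ false (mk _ false _ (_ ∷ _)) ∉ = ⊥-elim (∉ (here refl))

∉-options-of-endOrTomb : ∀ p G → tombstone p G ≡ false → EndOrTomb p G → g ∉ options p G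
∉-options-of-endOrTomb true  (mk false _ (_ ∷ _) _) _ ()
∉-options-of-endOrTomb false (mk _ false _ (_ ∷ _)) _ ()

mutual
  size : AForm → ℕ
  size (mk _ _ GL GR) = suc (sizes GL ℕ.+ sizes GR)

  sizes : List AForm → ℕ
  sizes []       = 0
  sizes (g ∷ gs) = size g ℕ.+ sizes gs

size-∈ : g ∈ gs → size g ≤ sizes gs
size-∈ {gs = g ∷ gs} (here refl) = m≤m+n (size g) (sizes gs)
size-∈ {gs = g ∷ gs} (there m)   = ≤-trans (size-∈ m) (m≤n+m (sizes gs) (size g))

size-options : ∀ p G → g ∈ options p G → size g < size G
size-options true  (mk _ _ GL GR) m = s≤s (≤-trans (size-∈ m) (m≤m+n (sizes GL) (sizes GR)))
size-options false (mk _ _ GL GR) m = s≤s (≤-trans (size-∈ m) (m≤n+m (sizes GR) (sizes GL)))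

size₃ : AForm → AForm → AForm → ℕ
size₃ P Q R = size P ℕ.+ size Q ℕ.+ size R

size₃-<₁ : ∀ p P Q R → g ∈ options p P → size₃ g Q R < size₃ P Q R
size₃-<₁ p P Q R m = +-monoˡ-< (size R) (+-monoˡ-< (size Q) (size-options p P m))

size₃-<₂ : ∀ p P Q R → g ∈ options p Q → size₃ P g R < size₃ P Q R
size₃-<₂ p P Q R m = +-monoˡ-< (size R) (+-monoʳ-< (size P) (size-options p Q m))

size₃-<₃ : ∀ p P Q R → g ∈ options p R → size₃ P Q g < size₃ P Q R
size₃-<₃ p P Q R m = +-monoʳ-< (size P ℕ.+ size Q) (size-options p R m)

Arrangement : Set
Arrangement = AForm → AForm → AForm → AForm

data Wins₃ (p : Player) (f : Arrangement) (P Q R : AForm) : Set where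
  ends  : EndOrTomb p P → EndOrTomb p Q → EndOrTomb p R → Wins₃ p f P Q R
  move₁ : g ∈ options p P → ¬ Wins (not p) (f g Q R) → Wins₃ p f P Q R
  move₂ : g ∈ options p Q → ¬ Wins (not p) (f P g R) → Wins₃ p f P Q R
  move₃ : g ∈ options p R → ¬ Wins (not p) (f P Q g) → Wins₃ p f P Q R

PlaysAsSum₃ : Arrangement → Set
PlaysAsSum₃ f = ∀ p P Q R → Wins p (f P Q R) ⇔ Wins₃ p f P Q R

rearrange : ∀ {f f′} → PlaysAsSum₃ f → PlaysAsSum₃ f′ →
            ∀ p P Q R → Acc _<_ (size₃ P Q R) → Wins p (f P Q R) → Wins p (f′ P Q R)
rearrange v v′ p P Q R (acc rs) w with to (v p P Q R) w
... | ends eP eQ eR = from (v′ p P Q R) (ends eP eQ eR)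
... | move₁ m ¬w =
  from (v′ p P Q R) (move₁ m (¬w ∘ rearrange v′ v (not p) _ Q R (rs (size₃-<₁ p P Q R m))))
... | move₂ m ¬w =
  from (v′ p P Q R) (move₂ m (¬w ∘ rearrange v′ v (not p) P _ R (rs (size₃-<₂ p P Q R m))))
... | move₃ m ¬w =
  from (v′ p P Q R) (move₃ m (¬w ∘ rearrange v′ v (not p) P Q _ (rs (size₃-<₃ p P Q R m))))

rightNested leftNested swapped : Arrangement
rightNested P Q R = P + (Q + R)
leftNested  P Q R = (P + Q) + R
swapped     P Q R = Q + (P + R)

rightNested-plays : PlaysAsSum₃ rightNested
rightNested-plays p P Q R = mk⇔ split join
  where
  split : Wins p (P + (Q + R)) → Wins₃ p rightNested P Q R
  split w with wins-cases p _ w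
  ... | inj₁ end = let eP , eQR = endOrTomb-+⁻ p P (Q + R) end
                       eQ , eR  = endOrTomb-+⁻ p Q R eQR
                   in ends eP eQ eR
  ... | inj₂ (_ , m , ¬w) with ∈-options-+⁻ p P (Q + R) m
  ... | inj₁ (_ , mP , refl) = move₁ mP ¬w
  ... | inj₂ (_ , mQR , refl) with ∈-options-+⁻ p Q R mQR
  ... | inj₁ (_ , mQ , refl) = move₂ mQ ¬w
  ... | inj₂ (_ , mR , refl) = move₃ mR ¬w

  join : Wins₃ p rightNested P Q R → Wins p (P + (Q + R))
  join (ends eP eQ eR) = wins-by-end p _ (endOrTomb-+⁺ p P (Q + R) eP (endOrTomb-+⁺ p Q R eQ eR))
  join (move₁ m ¬w)    = wins-by-move p _ (∈-options-+ˡ p P (Q + R) m) ¬w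
  join (move₂ m ¬w)    = wins-by-move p _ (∈-options-+ʳ p P (Q + R) (∈-options-+ˡ p Q R m)) ¬w
  join (move₃ m ¬w)    = wins-by-move p _ (∈-options-+ʳ p P (Q + R) (∈-options-+ʳ p Q R m)) ¬w

leftNested-plays : PlaysAsSum₃ leftNested
leftNested-plays p P Q R = mk⇔ split join
  where
  split : Wins p ((P + Q) + R) → Wins₃ p leftNested P Q R
  split w with wins-cases p _ w
  ... | inj₁ end = let ePQ , eR = endOrTomb-+⁻ p (P + Q) R end
                       eP , eQ  = endOrTomb-+⁻ p P Q ePQ
                   in ends eP eQ eR
  ... | inj₂ (_ , m , ¬w) with ∈-options-+⁻ p (P + Q) R m
  ... | inj₂ (_ , mR , refl) = move₃ mR ¬w
  ... | inj₁ (_ , mPQ , refl) with ∈-options-+⁻ p P Q mPQ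
  ... | inj₁ (_ , mP , refl) = move₁ mP ¬w
  ... | inj₂ (_ , mQ , refl) = move₂ mQ ¬w

  join : Wins₃ p leftNested P Q R → Wins p ((P + Q) + R)
  join (ends eP eQ eR) = wins-by-end p _ (endOrTomb-+⁺ p (P + Q) R (endOrTomb-+⁺ p P Q eP eQ) eR)
  join (move₁ m ¬w)    = wins-by-move p _ (∈-options-+ˡ p (P + Q) R (∈-options-+ˡ p P Q m)) ¬w
  join (move₂ m ¬w)    = wins-by-move p _ (∈-options-+ˡ p (P + Q) R (∈-options-+ʳ p P Q m)) ¬w
  join (move₃ m ¬w)    = wins-by-move p _ (∈-options-+ʳ p (P + Q) R m) ¬w

exchange₁₂ : ∀ {f} → Wins₃ p f Q P R → Wins₃ p (λ P Q R → f Q P R) P Q R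
exchange₁₂ (ends eQ eP eR) = ends eP eQ eR
exchange₁₂ (move₁ m ¬w)    = move₂ m ¬w
exchange₁₂ (move₂ m ¬w)    = move₁ m ¬w
exchange₁₂ (move₃ m ¬w)    = move₃ m ¬w

swapped-plays : PlaysAsSum₃ swapped
swapped-plays p P Q R =
  mk⇔ (exchange₁₂ ∘ to (rightNested-plays p Q P R)) (from (rightNested-plays p Q P R) ∘ exchange₁₂)

+-swap-wins : ∀ p P Q R → Wins p (P + (Q + R)) → Wins p (Q + (P + R))
+-swap-wins p P Q R = rearrange rightNested-plays swapped-plays p P Q R (<-wellFounded _)

+-assoc-wins : ∀ p P Q R → Wins p ((P + Q) + R) ⇔ Wins p (P + (Q + R))
+-assoc-wins p P Q R =
  mk⇔ (rearrange leftNested-plays rightNested-plays p P Q R (<-wellFounded _))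
      (rearrange rightNested-plays leftNested-plays p P Q R (<-wellFounded _))

Pointwise-∈ˡ : ∀ {A B : Set} {R : A → B → Set} {xs ys x} →
               Pointwise R xs ys → x ∈ xs → ∃[ y ] (y ∈ ys × R x y)
Pointwise-∈ˡ (r ∷ _)  (here refl) = _ , here refl , r
Pointwise-∈ˡ (_ ∷ rs) (there m)   = let y , my , r = Pointwise-∈ˡ rs m in y , there my , r

Pointwise-∈ʳ : ∀ {A B : Set} {R : A → B → Set} {xs ys y} →
               Pointwise R xs ys → y ∈ ys → ∃[ x ] (x ∈ xs × R x y)
Pointwise-∈ʳ (r ∷ _)  (here refl) = _ , here refl , r
Pointwise-∈ʳ (_ ∷ rs) (there m)   = let x , mx , r = Pointwise-∈ʳ rs m in x , there mx , r

module Expansion (𝒰 : Universe) where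
  open Universe 𝒰

  U-options : ∀ p → U G → g ∈ options p G → U g
  U-options true  = optsL
  U-options false = optsR

  Better : Player → AForm → AForm → Set
  Better true  G H = G ≥[ 𝒰 ] H
  Better false G H = H ≥[ 𝒰 ] G

  better-refl : ∀ p → Better p G G
  better-refl true  _ _ = id , id
  better-refl false _ _ = id , id

  better-wins : ∀ p → Better p G H → U X → Wins p (H + X) → Wins p (G + X)
  better-wins true  b u = proj₁ (b _ u)
  better-wins false b u = proj₂ (b _ u)

  better-loses : ∀ p → Better p G H → U X → Wins (not p) (G + X) → Wins (not p) (H + X)
  better-loses true  b u = proj₂ (b _ u)
  better-loses false b u = proj₁ (b _ u)

  better₂-wins : ∀ {G₁ H₁ G₂ H₂} p → Better p G₁ H₁ → Better p G₂ H₂ → U H₁ → U G₂ → U X →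
                 Wins p (H₁ + (H₂ + X)) → Wins p (G₁ + (G₂ + X))
  better₂-wins {X = X} {G₁} {H₁} {G₂} {H₂} p b₁ b₂ u₁ u₂ uX =
      better-wins p b₁ (sums u₂ uX) ∘ +-swap-wins p G₂ H₁ X
    ∘ better-wins p b₂ (sums u₁ uX) ∘ +-swap-wins p H₁ H₂ X

  better₂-loses : ∀ {G₁ H₁ G₂ H₂} p → Better p G₁ H₁ → Better p G₂ H₂ → U H₁ → U G₂ → U X →
                  Wins (not p) (G₁ + (G₂ + X)) → Wins (not p) (H₁ + (H₂ + X))
  better₂-loses {X = X} {G₁} {H₁} {G₂} {H₂} p b₁ b₂ u₁ u₂ uX =
      +-swap-wins (not p) H₂ H₁ X ∘ better-loses p b₂ (sums u₁ uX)
    ∘ +-swap-wins (not p) H₁ G₂ X ∘ better-loses p b₁ (sums u₂ uX)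

  EndRev : Player → AForm → AForm → Set
  EndRev p x E = ∃[ r ] (r ∈ options (not p) x × options p r ≡ [] × Better p E r)

  TombFill-∈ : ∀ {P b xs x} → TombFill 𝒰 P b xs → x ∈ xs → b ≡ true × P x
  TombFill-∈ (oneTomb px) (here refl) = refl , px

  TombFill-true : ∀ {P xs} → TombFill 𝒰 P true xs → ∃[ x ] (x ∈ xs × P x)
  TombFill-true (oneTomb px) = _ , here refl , px

  record ExpandedOptions (p : Player) (A E : AForm) : Set where
    field
      expanded added : List AForm
      expands        : Pointwise (Expands 𝒰) (options p A) expanded
      fills          : TombFill 𝒰 (λ x → EndRev p x E) (tombstone p A) added
      options≡       : options p E ≡ expanded ++ added

  expandedOptions : ∀ p → Expands 𝒰 A E → ExpandedOptions p A E
  expandedOptions true  (expand el _ fl _) =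
    record { expanded = _ ; added = _ ; expands = el ; fills = fl ; options≡ = refl }
  expandedOptions false (expand _ er _ fr) =
    record { expanded = _ ; added = _ ; expands = er ; fills = fr ; options≡ = refl }

  expansion-option⁺ : ∀ p → Expands 𝒰 A E → a ∈ options p A →
                      ∃[ e ] (e ∈ options p E × Expands 𝒰 a e)
  expansion-option⁺ p x m =
    let e , me , xe = Pointwise-∈ˡ expands m in e , subst (e ∈_) (sym options≡) (∈-++⁺ˡ me) , xe
    where open ExpandedOptions (expandedOptions p x)

  expansion-option⁻ : ∀ p → Expands 𝒰 A E → e ∈ options p E →
                      ∃[ a ] (a ∈ options p A × Expands 𝒰 a e) ⊎ (tombstone p A ≡ true × EndRev p e E)
  expansion-option⁻ p x m =
    [ inj₁ ∘ Pointwise-∈ʳ expands , inj₂ ∘ TombFill-∈ fills ]′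
      (∈-++⁻ expanded (subst (_ ∈_) options≡ m))
    where open ExpandedOptions (expandedOptions p x)

  expansion-tombstone : ∀ p → Expands 𝒰 A E → tombstone p A ≡ true →
                        ∃[ x ] (x ∈ options p E × EndRev p x E)
  expansion-tombstone p x t =
    let y , my , ry = TombFill-true (subst (λ b → TombFill 𝒰 _ b added) t fills)
    in y , subst (y ∈_) (sym options≡) (∈-++⁺ʳ expanded my) , ry
    where open ExpandedOptions (expandedOptions p x)

  expansion-noTombstone : ∀ p → Expands 𝒰 A E → tombstone p E ≡ false
  expansion-noTombstone true  (expand _ _ _ _) = refl
  expansion-noTombstone false (expand _ _ _ _) = refl

  expansion-endOrTomb⁻ : ∀ p → Expands 𝒰 A E → EndOrTomb p E → EndOrTomb p A
  expansion-endOrTomb⁻ {A} {E} p x end = endOrTomb-of-∉ p A λ m →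
    let _ , me , _ = expansion-option⁺ p x m
    in ∉-options-of-endOrTomb p E (expansion-noTombstone p x) end me

  expansion-endOrTomb⁺ : ∀ p → Expands 𝒰 A E → tombstone p A ≡ false → EndOrTomb p A → EndOrTomb p E
  expansion-endOrTomb⁺ {A} {E} p x t end = endOrTomb-of-∉ p E λ m →
    [ (λ (_ , ma , _) → ∉-options-of-endOrTomb p A t end ma)
    , (λ (t′ , _) → true≢false (trans (sym t′) t))
    ]′ (expansion-option⁻ p x m)
    where
    true≢false : ¬ true ≡ false
    true≢false ()

  _⇝_ : AForm → AForm → Set
  A ⇝ E = Expands 𝒰 A E × U E

  -- What may replace the expansion E of A when p is to move: E itself or, if A carries
  -- p's tombstone, a p-end dominated by E.  The index lets `itself` be traded only once
  -- for `tombEnd`, which is what makes `expansion-wins⁻` terminate.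
  data StandIn (p : Player) (A E : AForm) : ℕ → AForm → Set where
    itself  : StandIn p A E 1 E
    tombEnd : tombstone p A ≡ true → options p r ≡ [] → U r → Better p E r → StandIn p A E 0 r

  standIn-better : ∀ p → StandIn p A E k s → Better p E s
  standIn-better p itself            = better-refl p
  standIn-better p (tombEnd _ _ _ b) = b

  standIn-U : U E → StandIn p A E k s → U s
  standIn-U u itself            = u
  standIn-U _ (tombEnd _ _ u _) = u

  standIn-endOrTomb⁻ : ∀ p → Expands 𝒰 A E → StandIn p A E k s → EndOrTomb p s → EndOrTomb p A
  standIn-endOrTomb⁻ p x itself            end = expansion-endOrTomb⁻ p x end
  standIn-endOrTomb⁻ p x (tombEnd t _ _ _) _   = endOrTomb-of-tombstone p _ t

  standIn-of-endOrTomb : ∀ p → A ⇝ E → EndOrTomb p A →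
                         ∃[ k ] ∃[ s ] (StandIn p A E k s × EndOrTomb p s)
  standIn-of-endOrTomb {A} p (x , u) end with tombstone p A in t
  ... | false = 1 , _ , itself , expansion-endOrTomb⁺ p x t end
  ... | true  = let _ , my , r , mr , noMove , b = expansion-tombstone p x t
                in 0 , r , tombEnd t noMove (U-options (not p) (U-options p u my) mr) b
                 , endOrTomb-of-∉ p r (∉-≡[] noMove)

  standIns-wins : ∀ p → U EA → U EB → U X → StandIn p A EA i s₁ → StandIn p B EB j s₂ →
                  Wins p (s₁ + (s₂ + X)) → Wins p (EA + (EB + X))
  standIns-wins p uA uB uX st₁ st₂ =
    better₂-wins p (standIn-better p st₁) (standIn-better p st₂) (standIn-U uA st₁) uB uX

  standIns-loses : ∀ p → U EA → U EB → U X → StandIn p A EA i s₁ → StandIn p B EB j s₂ →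
                   Wins (not p) (EA + (EB + X)) → Wins (not p) (s₁ + (s₂ + X))
  standIns-loses p uA uB uX st₁ st₂ =
    better₂-loses p (standIn-better p st₁) (standIn-better p st₂) (standIn-U uA st₁) uB uX

  mutual
    expansion-wins⁺ : ∀ p → A ⇝ EA → B ⇝ EB → U X → Acc _<_ (size₃ A B X) →
                      Wins p (A + (B + X)) → Wins p (EA + (EB + X))
    expansion-wins⁺ {A} {EA} {B} {EB} {X} p A⇝@(xA , uA) B⇝@(xB , uB) uX (acc rs) w
      with to (rightNested-plays p A B X) w
    ... | ends endA endB endX =
      let _ , s₁ , st₁ , end₁ = standIn-of-endOrTomb p A⇝ endA
          _ , s₂ , st₂ , end₂ = standIn-of-endOrTomb p B⇝ endB
      in standIns-wins p uA uB uX st₁ st₂ (from (rightNested-plays p s₁ s₂ X) (ends end₁ end₂ endX))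
    ... | move₁ m ¬w =
      let _ , me , xe = expansion-option⁺ p xA m
      in from (rightNested-plays p EA EB X) (move₁ me (¬w ∘
           expansion-wins⁻ (not p) (xe , U-options p uA me) B⇝ uX (rs (size₃-<₁ p A B X m)) itself itself))
    ... | move₂ m ¬w =
      let _ , me , xe = expansion-option⁺ p xB m
      in from (rightNested-plays p EA EB X) (move₂ me (¬w ∘
           expansion-wins⁻ (not p) A⇝ (xe , U-options p uB me) uX (rs (size₃-<₂ p A B X m)) itself itself))
    ... | move₃ m ¬w =
      from (rightNested-plays p EA EB X) (move₃ m (¬w ∘
        expansion-wins⁻ (not p) A⇝ B⇝ (U-options p uX m) (rs (size₃-<₃ p A B X m)) itself itself))

    expansion-wins⁻ : ∀ p → A ⇝ EA → B ⇝ EB → U X → Acc _<_ (size₃ A B X) →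
                      StandIn p A EA i s₁ → StandIn p B EB j s₂ →
                      Wins p (s₁ + (s₂ + X)) → Wins p (A + (B + X))
    expansion-wins⁻ {A} {EA} {B} {EB} {X} {s₁ = s₁} {s₂ = s₂} p A⇝ B⇝ uX ac st₁ st₂ w
      with to (rightNested-plays p s₁ s₂ X) w
    ... | ends end₁ end₂ endX =
      from (rightNested-plays p A B X)
        (ends (standIn-endOrTomb⁻ p (proj₁ A⇝) st₁ end₁)
              (standIn-endOrTomb⁻ p (proj₁ B⇝) st₂ end₂) endX)
    expansion-wins⁻ p _ _ _ _ (tombEnd _ noMove _ _) _ _ | move₁ m _ = ⊥-elim (∉-≡[] noMove m)
    expansion-wins⁻ p _ _ _ _ _ (tombEnd _ noMove _ _) _ | move₂ m _ = ⊥-elim (∉-≡[] noMove m)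
    expansion-wins⁻ {A} {EA} {B} {EB} {X} {s₂ = s₂} p A⇝@(xA , uA) B⇝@(_ , uB) uX (acc rs) itself st₂ w
      | move₁ {e} m ¬w =
      [ (λ (a , ma , xe) → from (rightNested-plays p A B X) (move₁ ma (¬w ∘
          standIns-loses p ue uB uX (itself {A = a}) st₂ ∘
          expansion-wins⁺ (not p) (xe , ue) B⇝ uX (rs (size₃-<₁ p A B X ma)))))
      , (λ (t , r , mr , noMove , b) →
          expansion-wins⁻ p A⇝ B⇝ uX (acc rs) (tombEnd t noMove (U-options (not p) ue mr) b) st₂
            (loses⇒wins-options p (e + (s₂ + X)) ¬w (∈-options-+ˡ (not p) e (s₂ + X) mr)))
      ]′ (expansion-option⁻ p xA m)
      where ue = U-options p uA m
    expansion-wins⁻ {A} {EA} {B} {EB} {X} {s₁ = s₁} p A⇝@(_ , uA) B⇝@(xB , uB) uX (acc rs) st₁ itself w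
      | move₂ {e} m ¬w =
      [ (λ (b , mb , xe) → from (rightNested-plays p A B X) (move₂ mb (¬w ∘
          standIns-loses p uA ue uX st₁ (itself {A = b}) ∘
          expansion-wins⁺ (not p) A⇝ (xe , ue) uX (rs (size₃-<₂ p A B X mb)))))
      , (λ (t , r , mr , noMove , b) →
          expansion-wins⁻ p A⇝ B⇝ uX (acc rs) st₁ (tombEnd t noMove (U-options (not p) ue mr) b)
            (loses⇒wins-options p (s₁ + (e + X)) ¬w
              (∈-options-+ʳ (not p) s₁ (e + X) (∈-options-+ˡ (not p) e X mr))))
      ]′ (expansion-option⁻ p xB m)
      where ue = U-options p uB m
    expansion-wins⁻ {A} {EA} {B} {EB} {X} p A⇝@(_ , uA) B⇝@(_ , uB) uX (acc rs) st₁ st₂ w | move₃ m ¬w =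
      let ux = U-options p uX m
      in from (rightNested-plays p A B X) (move₃ m (¬w ∘
           standIns-loses p uA uB ux st₁ st₂ ∘
           expansion-wins⁺ (not p) A⇝ B⇝ ux (rs (size₃-<₃ p A B X m))))

  expansion-wins : ∀ p → A ⇝ EA → B ⇝ EB → U X → Wins p (A + (B + X)) ⇔ Wins p (EA + (EB + X))
  expansion-wins p A⇝ B⇝ uX = mk⇔ (expansion-wins⁺ p A⇝ B⇝ uX (<-wellFounded _))
                                  (expansion-wins⁻ p A⇝ B⇝ uX (<-wellFounded _) itself itself)

  mutual
    expands-self : TombFree E → Expands 𝒰 E E
    expands-self (tf {GL} {GR} tl tr) =
      subst₂ (λ EL ER → Expands 𝒰 (mk false false GL GR) (mk false false EL ER))
             (++-identityʳ GL) (++-identityʳ GR)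
             (expand (pointwise-self tl) (pointwise-self tr) noTomb noTomb)

    pointwise-self : All TombFree gs → Pointwise (Expands 𝒰) gs gs
    pointwise-self []       = []
    pointwise-self (t ∷ ts) = expands-self t ∷ pointwise-self ts

  ⇝-self : U E → E ⇝ E
  ⇝-self u = expands-self (games u) , u

  wins-+-expansion : ∀ p → A ⇝ EA → B ⇝ EB → U X → Wins p ((A + B) + X) ⇔ Wins p (A + (EB + X))
  wins-+-expansion {A} {EA} {B} {EB} {X} p A⇝ B⇝ uX =
    ⇔-trans (+-assoc-wins p A B X)
      (⇔-trans (expansion-wins p A⇝ B⇝ uX) (⇔-sym (expansion-wins p A⇝ (⇝-self (proj₂ B⇝)) uX)))

theorem2p7 : (𝒰 : Universe) (G H J : AForm) →
    Hat 𝒰 G → Hat 𝒰 H → Hat 𝒰 J →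
    G ≥[ 𝒰 ] H →
    (G + J) ≥[ 𝒰 ] (H + J)
theorem2p7 𝒰 G H J (_ , G⇝) (_ , H⇝) (EJ , J⇝) G≥H X uX =
    from (wins-+-expansion true G⇝ J⇝ uX) ∘ proj₁ G≥H-at ∘ to (wins-+-expansion true H⇝ J⇝ uX)
  , from (wins-+-expansion false H⇝ J⇝ uX) ∘ proj₂ G≥H-at ∘ to (wins-+-expansion false G⇝ J⇝ uX)
  where
  open Universe 𝒰
  open Expansion 𝒰
  G≥H-at : (G + (EJ + X)) o≥ (H + (EJ + X))
  G≥H-at = G≥H (EJ + X) (sums (proj₂ J⇝) uX)
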